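{- Let $G$ be a graph belonging to the family $\mathcal{F}_1$. Then the singleton coalition graph ${\rm CG}(G,\Gamma_1)$ belongs to the family $\mathcal{H}_1$.
   Context: All graphs are finite and simple. A full vertex of $G=(V,E)$ is a vertex adjacent to all other vertices. A set $D\subseteq V$ is dominating if every vertex not in $D$ has a neighbor in $D$. Two disjoint sets $A,B\subseteq V$ form a coalition if neither $A$ nor $B$ is a dominating set but $A\cup B$ is. A coalition partition of $G$ is a partition $\mathcal{P}$ of $V$ such that every member of $\mathcal{P}$ is either a dominating set of cardinality 1, or is not dominating and forms a coalition with some other member of $\mathcal{P}$. The coalition graph ${\rm CG}(G,\mathcal{P})$ has vertex set $\mathcal{P}$, two members being adjacent iff they form a coalition. $\Gamma_1$ denotes the partition of $V$ into singletons; $G$ is a singleton-partition graph (SP-graph) if $\Gamma_1$ is a coalition partition of $G$, and then ${\rm CG}(G,\Gamma_1)$ is its singleton coalition graph (vertex $\{v\}$ identified with $v$). The family $\mathcal{F}_1$: $G$ has vertex set $\{x,y,w\}\cup P\cup Q$, where $x,y,w$ are distinct, $P,Q$ are disjoint sets disjoint from $\{x,y,w\}$, $|P\cup Q|\ge 1$, and if $Q\neq\emptyset$ then $|Q|\ge 2$. Edges: $N(x)=\{y\}$; $N(w)=P\cup Q$; each $p\in P$ is adjacent to all vertices of $(P\cup Q)\setminus\{p\}$; if $Q\ne\emptyset$, $y$ is adjacent to all vertices of $Q$, and edges (possibly none) are added between vertices of $Q$ so that $G[Q]$ has no full vertex; finally any number of edges between $y$ and vertices of $P$ may be added. (Every graph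 in $\mathcal{F}_1$ is an SP-graph.) The family $\mathcal{H}_1$: all bipartite graphs with parts $A_1=\{x_1,y_1\}$ and $B_1=P_1\cup\{w_1\}\cup Q_1$, where $|P_1\cup Q_1|\ge1$ and if $Q_1\neq\emptyset$ then $|Q_1|\ge 2$; $y_1$ is adjacent to every vertex of $B_1$, and $x_1$ is adjacent exactly to the vertices of $P_1\cup\{w_1\}$; there are no other edges. -}

module Defs where

open import Data.Nat using (ℕ)
open import Data.Fin using (Fin)
open import Data.Product using (Σ; ∃; _×_; _,_; proj₁; proj₂)
open import Data.Sum using (_⊎_; inj₁; inj₂)
open import Data.Unit using (⊤)
open import Data.Empty using (⊥)
open import Relation.Nullary using (¬_)
open import Relation.Binary.PropositionalEquality using (_≡_; _≢_; refl)

record Graph (n : ℕ) : Set₁ where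
  field
    Adj    : Fin n → Fin n → Set
    adj-sym    : ∀ {u v} → Adj u v → Adj v u
    irrefl : ∀ {u} → ¬ Adj u u
open Graph public

VSet : ℕ → Set₁
VSet n = Fin n → Set

_∪_ : ∀ {n} → VSet n → VSet n → VSet n
(A ∪ B) v = A v ⊎ B v

singleton : ∀ {n} → Fin n → VSet n
singleton u v = v ≡ u

Dominating : ∀ {n} → Graph n → VSet n → Set
Dominating G D = ∀ v → D v ⊎ (∃ λ u → D u × Adj G u v)

Disjoint : ∀ {n} → VSet n → VSet n → Set
Disjoint A B = ∀ v → A v → B v → ⊥

Coalition : ∀ {n} → Graph n → VSet n → VSet n → Set
Coalition G A B =
  Disjoint A B × ¬ Dominating G A × ¬ Dominating G B × Dominating G (A ∪ B)

private
  ∪-swap : ∀ {n} (G : Graph n) (A B : VSet n) →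
           Dominating G (A ∪ B) → Dominating G (B ∪ A)
  ∪-swap G A B d v with d v
  ... | inj₁ (inj₁ a) = inj₁ (inj₂ a)
  ... | inj₁ (inj₂ b) = inj₁ (inj₁ b)
  ... | inj₂ (u , inj₁ a , e) = inj₂ (u , inj₂ a , e)
  ... | inj₂ (u , inj₂ b , e) = inj₂ (u , inj₁ b , e)

  coal-sym : ∀ {n} (G : Graph n) {u v : Fin n} →
             Coalition G (singleton u) (singleton v) →
             Coalition G (singleton v) (singleton u)
  coal-sym G {u} {v} (dj , na , nb , d) =
    (λ w p q → dj w q p) , nb , na , ∪-swap G (singleton u) (singleton v) d

  coal-irrefl : ∀ {n} (G : Graph n) {u : Fin n} →
                ¬ Coalition G (singleton u) (singleton u)
  coal-irrefl G {u} (dj , _) = dj u refl refl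

-- The singleton coalition graph CG(G, Γ₁): vertex {v} identified with v,
-- u ~ v iff {u} and {v} form a coalition.
singletonCG : ∀ {n} → Graph n → Graph n
singletonCG G = record
  { Adj    = λ u v → Coalition G (singleton u) (singleton v)
  ; adj-sym    = coal-sym G
  ; irrefl = coal-irrefl G
  }

data Role : Set where
  rx ry rw rp rq : Role

-- Edge specification of the family F₁ between two distinct vertices with the
-- given roles, applied to the adjacency proposition A.
-- A  : edge required;  ¬ A : edge forbidden;  ⊤ : edge optional.
F1Spec : Role → Role → Set → Set
F1Spec rx rx A = ¬ A
F1Spec rx ry A = A
F1Spec rx rw A = ¬ A
F1Spec rx rp A = ¬ A
F1Spec rx rq A = ¬ A
F1Spec ry rx A = A
F1Spec ry ry A = ¬ A
F1Spec ry rw A = ¬ A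
F1Spec ry rp A = ⊤
F1Spec ry rq A = A
F1Spec rw rx A = ¬ A
F1Spec rw ry A = ¬ A
F1Spec rw rw A = ¬ A
F1Spec rw rp A = A
F1Spec rw rq A = A
F1Spec rp rx A = ¬ A
F1Spec rp ry A = ⊤
F1Spec rp rw A = A
F1Spec rp rp A = A
F1Spec rp rq A = A
F1Spec rq rx A = ¬ A
F1Spec rq ry A = A
F1Spec rq rw A = A
F1Spec rq rp A = A
F1Spec rq rq A = ⊤

-- Edge specification of the family H₁ (x,y ↦ x₁,y₁; w ↦ w₁; P ↦ P₁; Q ↦ Q₁).
H1Spec : Role → Role → Set → Set
H1Spec rx rx A = ¬ A
H1Spec rx ry A = ¬ A
H1Spec rx rw A = A
H1Spec rx rp A = A
H1Spec rx rq A = ¬ A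
H1Spec ry rx A = ¬ A
H1Spec ry ry A = ¬ A
H1Spec ry rw A = A
H1Spec ry rp A = A
H1Spec ry rq A = A
H1Spec rw rx A = A
H1Spec rw ry A = A
H1Spec rw rw A = ¬ A
H1Spec rw rp A = ¬ A
H1Spec rw rq A = ¬ A
H1Spec rp rx A = A
H1Spec rp ry A = A
H1Spec rp rw A = ¬ A
H1Spec rp rp A = ¬ A
H1Spec rp rq A = ¬ A
H1Spec rq rx A = ¬ A
H1Spec rq ry A = A
H1Spec rq rw A = ¬ A
H1Spec rq rp A = ¬ A
H1Spec rq rq A = ¬ A

record Labelling (n : ℕ) : Set where
  field
    role   : Fin n → Role
    x y w  : Fin n
    role-x : role x ≡ rx
    role-y : role y ≡ ry
    role-w : role w ≡ rw
    uniq-x : ∀ v → role v ≡ rx → v ≡ x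
    uniq-y : ∀ v → role v ≡ ry → v ≡ y
    uniq-w : ∀ v → role v ≡ rw → v ≡ w
    PQ-nonempty : ∃ λ v → role v ≡ rp ⊎ role v ≡ rq
    Q-size : (∃ λ q → role q ≡ rq) →
             Σ (Fin n) λ q₁ → Σ (Fin n) λ q₂ →
               role q₁ ≡ rq × role q₂ ≡ rq × q₁ ≢ q₂
open Labelling public

InF1 : ∀ {n} → Graph n → Set
InF1 {n} G = Σ (Labelling n) λ L →
    (∀ u v → u ≢ v → F1Spec (role L u) (role L v) (Adj G u v))
  × -- G[Q] has no full vertex (only relevant when Q ≠ ∅)
    (∀ q → role L q ≡ rq →
       ∃ λ q' → role L q' ≡ rq × q' ≢ q × ¬ Adj G q q')

InH1 : ∀ {n} → Graph n → Set
InH1 {n} H = Σ (Labelling n) λ L →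
    ∀ u v → u ≢ v → H1Spec (role L u) (role L v) (Adj H u v)

-- The labelling of G as {x} ∪ {y} ∪ {w} ∪ P ∪ Q also exhibits CG(G, Γ₁) as a member
-- of H₁.  No single vertex dominates G ({x} and {y} miss w, every other vertex misses x),
-- so two distinct singletons form a coalition exactly when the pair dominates, and this
-- is decided role by role: x and y together with w or a vertex of P dominate, as do y and
-- a vertex of Q; two vertices of {w} ∪ P ∪ Q miss x, {x, y} misses w, and {x, q} misses a
-- vertex of Q not adjacent to q, which exists because G[Q] has no full vertex.
module Submission where

open import Data.Nat using (ℕ)
open import Data.Fin using (Fin; _≟_)
open import Data.Product using (∃; _×_; _,_)
open import Data.Sum using (_⊎_; inj₁; inj₂; [_,_]; swap)
open import Data.Empty using (⊥-elim)
open import Function using (_∘_)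
open import Relation.Nullary using (¬_; yes; no)
open import Relation.Binary.PropositionalEquality using (_≡_; _≢_; refl; sym; trans; subst₂)
open import Defs

closedNbhd : ∀ {n} → Graph n → Fin n → VSet n
closedNbhd G u t = t ≡ u ⊎ Adj G u t

module _ {n} (G : Graph n) where

  singleton-undominated : ∀ {u} t → ¬ closedNbhd G u t → ¬ Dominating G (singleton u)
  singleton-undominated t out d with d t
  ... | inj₁ p = out (inj₁ p)
  ... | inj₂ (_ , refl , e) = out (inj₂ e)

  pair-undominated : ∀ {u v} t → ¬ closedNbhd G u t → ¬ closedNbhd G v t →
                     ¬ Dominating G (singleton u ∪ singleton v)
  pair-undominated t out₁ out₂ d with d t
  ... | inj₁ (inj₁ p) = out₁ (inj₁ p)
  ... | inj₁ (inj₂ p) = out₂ (inj₁ p)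
  ... | inj₂ (_ , inj₁ refl , e) = out₁ (inj₂ e)
  ... | inj₂ (_ , inj₂ refl , e) = out₂ (inj₂ e)

  pair-dominating : ∀ {u v} → (∀ t → (closedNbhd G u ∪ closedNbhd G v) t) →
                    Dominating G (singleton u ∪ singleton v)
  pair-dominating {u} {v} cov t with cov t
  ... | inj₁ (inj₁ p) = inj₁ (inj₁ p)
  ... | inj₁ (inj₂ e) = inj₂ (u , inj₁ refl , e)
  ... | inj₂ (inj₁ p) = inj₁ (inj₂ p)
  ... | inj₂ (inj₂ e) = inj₂ (v , inj₂ refl , e)

  singleton-coalition : (∀ t → ¬ Dominating G (singleton t)) → ∀ {u v} → u ≢ v →
                        Dominating G (singleton u ∪ singleton v) →
                        Coalition G (singleton u) (singleton v)
  singleton-coalition none u≢v d = (λ _ p q → u≢v (trans (sym p) q)) , none _ , none _ , d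

-- Covers a b: F₁ forces every vertex of role b into the closed neighbourhood of every
-- vertex of role a.  Misses a b: F₁ forces every vertex of role b out of it.
data Covers : Role → Role → Set where
  cov-xx : Covers rx rx
  cov-xy : Covers rx ry
  cov-yx : Covers ry rx
  cov-yy : Covers ry ry
  cov-yq : Covers ry rq
  cov-ww : Covers rw rw
  cov-wp : Covers rw rp
  cov-wq : Covers rw rq
  cov-pw : Covers rp rw
  cov-pp : Covers rp rp
  cov-pq : Covers rp rq
  cov-qw : Covers rq rw
  cov-qp : Covers rq rp

data Misses : Role → Role → Set where
  miss-xw : Misses rx rw
  miss-xq : Misses rx rq
  miss-yw : Misses ry rw
  miss-wx : Misses rw rx
  miss-px : Misses rp rx
  miss-qx : Misses rq rx

misses-distinct : ∀ {a b} → Misses a b → b ≢ a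
misses-distinct miss-xw ()
misses-distinct miss-xq ()
misses-distinct miss-yw ()
misses-distinct miss-wx ()
misses-distinct miss-px ()
misses-distinct miss-qx ()

misses-forbidden : ∀ {a b A} → Misses a b → F1Spec a b A → ¬ A
misses-forbidden miss-xw s = s
misses-forbidden miss-xq s = s
misses-forbidden miss-yw s = s
misses-forbidden miss-wx s = s
misses-forbidden miss-px s = s
misses-forbidden miss-qx s = s

CoveredBy : Role → Role → Set
CoveredBy a c = ∀ b → Covers a b ⊎ Covers c b

x-w-cover : CoveredBy rx rw
x-w-cover rx = inj₁ cov-xx
x-w-cover ry = inj₁ cov-xy
x-w-cover rw = inj₂ cov-ww
x-w-cover rp = inj₂ cov-wp
x-w-cover rq = inj₂ cov-wq

x-p-cover : CoveredBy rx rp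
x-p-cover rx = inj₁ cov-xx
x-p-cover ry = inj₁ cov-xy
x-p-cover rw = inj₂ cov-pw
x-p-cover rp = inj₂ cov-pp
x-p-cover rq = inj₂ cov-pq

y-w-cover : CoveredBy ry rw
y-w-cover rx = inj₁ cov-yx
y-w-cover ry = inj₁ cov-yy
y-w-cover rw = inj₂ cov-ww
y-w-cover rp = inj₂ cov-wp
y-w-cover rq = inj₂ cov-wq

y-p-cover : CoveredBy ry rp
y-p-cover rx = inj₁ cov-yx
y-p-cover ry = inj₁ cov-yy
y-p-cover rw = inj₂ cov-pw
y-p-cover rp = inj₂ cov-pp
y-p-cover rq = inj₂ cov-pq

y-q-cover : CoveredBy ry rq
y-q-cover rx = inj₁ cov-yx
y-q-cover ry = inj₁ cov-yy
y-q-cover rw = inj₂ cov-qw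
y-q-cover rp = inj₂ cov-qp
y-q-cover rq = inj₁ cov-yq

module F₁-coalitions {n} (G : Graph n) (L : Labelling n)
  (spec : ∀ u v → u ≢ v → F1Spec (role L u) (role L v) (Adj G u v))
  (no-full : ∀ q → role L q ≡ rq → ∃ λ q' → role L q' ≡ rq × q' ≢ q × ¬ Adj G q q')
  where

  private
    R = role L
    S = singleton {n}

  distinct-roles : ∀ {u v a b} → R u ≡ a → R v ≡ b → a ≢ b → u ≢ v
  distinct-roles eu ev a≢b refl = a≢b (trans (sym eu) ev)

  forced : ∀ {u v a b} → R u ≡ a → R v ≡ b → u ≢ v → F1Spec a b (Adj G u v)
  forced {u} {v} eu ev u≢v = subst₂ (λ a b → F1Spec a b (Adj G u v)) eu ev (spec u v u≢v)

  shared-role : ∀ {a c t u} → (∀ v → R v ≡ a → v ≡ c) → R t ≡ a → R u ≡ a → t ≡ u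
  shared-role {t = t} {u} uniq et eu = trans (uniq t et) (sym (uniq u eu))

  covers-adj : ∀ {a b u t} → Covers a b → R u ≡ a → R t ≡ b → t ≢ u → Adj G u t
  covers-adj cov-xx eu et t≢u = ⊥-elim (t≢u (shared-role (uniq-x L) et eu))
  covers-adj cov-yy eu et t≢u = ⊥-elim (t≢u (shared-role (uniq-y L) et eu))
  covers-adj cov-ww eu et t≢u = ⊥-elim (t≢u (shared-role (uniq-w L) et eu))
  covers-adj cov-xy eu et t≢u = forced eu et (t≢u ∘ sym)
  covers-adj cov-yx eu et t≢u = forced eu et (t≢u ∘ sym)
  covers-adj cov-yq eu et t≢u = forced eu et (t≢u ∘ sym)
  covers-adj cov-wp eu et t≢u = forced eu et (t≢u ∘ sym)
  covers-adj cov-wq eu et t≢u = forced eu et (t≢u ∘ sym)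
  covers-adj cov-pw eu et t≢u = forced eu et (t≢u ∘ sym)
  covers-adj cov-pp eu et t≢u = forced eu et (t≢u ∘ sym)
  covers-adj cov-pq eu et t≢u = forced eu et (t≢u ∘ sym)
  covers-adj cov-qw eu et t≢u = forced eu et (t≢u ∘ sym)
  covers-adj cov-qp eu et t≢u = forced eu et (t≢u ∘ sym)

  covered : ∀ {a b u t} → Covers a b → R u ≡ a → R t ≡ b → closedNbhd G u t
  covered {u = u} {t} c eu et with t ≟ u
  ... | yes t≡u = inj₁ t≡u
  ... | no t≢u = inj₂ (covers-adj c eu et t≢u)

  missed : ∀ {a b u t} → Misses a b → R u ≡ a → R t ≡ b → ¬ closedNbhd G u t
  missed m eu et (inj₁ t≡u) = distinct-roles et eu (misses-distinct m) t≡u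
  missed m eu et (inj₂ e) = misses-forbidden m (forced eu et (λ { refl → irrefl G e })) e

  no-dominating-vertex : ∀ u → ¬ Dominating G (S u)
  no-dominating-vertex u with R u in eu
  ... | rx = singleton-undominated G (w L) (missed miss-xw eu (role-w L))
  ... | ry = singleton-undominated G (w L) (missed miss-yw eu (role-w L))
  ... | rw = singleton-undominated G (x L) (missed miss-wx eu (role-x L))
  ... | rp = singleton-undominated G (x L) (missed miss-px eu (role-x L))
  ... | rq = singleton-undominated G (x L) (missed miss-qx eu (role-x L))

  covered-coalition : ∀ {u v a c} → R u ≡ a → R v ≡ c → u ≢ v → CoveredBy a c →
                      Coalition G (S u) (S v)
  covered-coalition {u} {v} eu ev u≢v cov =
    singleton-coalition G no-dominating-vertex u≢v (pair-dominating G covers)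
    where
    covers : ∀ t → (closedNbhd G u ∪ closedNbhd G v) t
    covers t with cov (R t)
    ... | inj₁ c = inj₁ (covered c eu refl)
    ... | inj₂ c = inj₂ (covered c ev refl)

  missed-no-coalition : ∀ {u v t a c b} → R u ≡ a → R v ≡ c → R t ≡ b →
                        Misses a b → Misses c b → ¬ Coalition G (S u) (S v)
  missed-no-coalition {t = t} eu ev et m₁ m₂ (_ , _ , _ , d) =
    pair-undominated G t (missed m₁ eu et) (missed m₂ ev et) d

  x-q-no-coalition : ∀ {u v} → R u ≡ rx → R v ≡ rq → ¬ Coalition G (S u) (S v)
  x-q-no-coalition {v = v} eu ev (_ , _ , _ , d) with no-full v ev
  ... | q' , eq' , q'≢v , ¬adj =
    pair-undominated G q' (missed miss-xq eu eq') [ q'≢v , ¬adj ] d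

  coalition-roles : ∀ u v → u ≢ v → H1Spec (R u) (R v) (Coalition G (S u) (S v))
  coalition-roles u v u≢v with R u in eu | R v in ev
  ... | rx | rx = λ _ → u≢v (shared-role (uniq-x L) eu ev)
  ... | rx | ry = missed-no-coalition eu ev (role-w L) miss-xw miss-yw
  ... | rx | rw = covered-coalition eu ev u≢v x-w-cover
  ... | rx | rp = covered-coalition eu ev u≢v x-p-cover
  ... | rx | rq = x-q-no-coalition eu ev
  ... | ry | rx = missed-no-coalition eu ev (role-w L) miss-yw miss-xw
  ... | ry | ry = λ _ → u≢v (shared-role (uniq-y L) eu ev)
  ... | ry | rw = covered-coalition eu ev u≢v y-w-cover
  ... | ry | rp = covered-coalition eu ev u≢v y-p-cover
  ... | ry | rq = covered-coalition eu ev u≢v y-q-cover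
  ... | rw | rx = covered-coalition eu ev u≢v (swap ∘ x-w-cover)
  ... | rw | ry = covered-coalition eu ev u≢v (swap ∘ y-w-cover)
  ... | rw | rw = missed-no-coalition eu ev (role-x L) miss-wx miss-wx
  ... | rw | rp = missed-no-coalition eu ev (role-x L) miss-wx miss-px
  ... | rw | rq = missed-no-coalition eu ev (role-x L) miss-wx miss-qx
  ... | rp | rx = covered-coalition eu ev u≢v (swap ∘ x-p-cover)
  ... | rp | ry = covered-coalition eu ev u≢v (swap ∘ y-p-cover)
  ... | rp | rw = missed-no-coalition eu ev (role-x L) miss-px miss-wx
  ... | rp | rp = missed-no-coalition eu ev (role-x L) miss-px miss-px
  ... | rp | rq = missed-no-coalition eu ev (role-x L) miss-px miss-qx
  ... | rq | rx = x-q-no-coalition ev eu ∘ adj-sym (singletonCG G)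
  ... | rq | ry = covered-coalition eu ev u≢v (swap ∘ y-q-cover)
  ... | rq | rw = missed-no-coalition eu ev (role-x L) miss-qx miss-wx
  ... | rq | rp = missed-no-coalition eu ev (role-x L) miss-qx miss-px
  ... | rq | rq = missed-no-coalition eu ev (role-x L) miss-qx miss-qx

theorem4 : ∀ (n : ℕ) (G : Graph n) → InF1 G → InH1 (singletonCG G)
theorem4 n G (L , spec , no-full) = L , F₁-coalitions.coalition-roles G L spec no-full
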